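{- Let \(\mathcal V\) be a universe. (i) There is a nontrivial small \(\delta_{\mathcal V}\)-complete poset if and only if the type \(\Omega^{\lnot\lnot}_{\mathcal V}\) is \(\mathcal V\)-small. (ii) There is a positive small \(\delta_{\mathcal V}\)-complete poset if and only if the type \(\Omega_{\mathcal V}\) is \(\mathcal V\)-small.
   Context: Work in univalent foundations: intensional Martin-Löf type theory with a hierarchy of universes, \(\Sigma\), \(\Pi\), identity types, function extensionality, propositional extensionality, and propositional truncations \(\|X\|\) (living in the same universe as \(X\)). "There is" means that one can construct such a structure; the carrier may live in any universe. A type \(X\) is \(\mathcal V\)-small if there is a type \(Y:\mathcal V\) with \(Y\simeq X\). \(\Omega_{\mathcal V}\) is the type of propositions (subsingletons) in \(\mathcal V\); \(\Omega^{\lnot\lnot}_{\mathcal V}\) is the type of propositions \(P:\mathcal V\) with \(\lnot\lnot P\to P\). A poset is a type \(X\) with a proposition-valued reflexive, transitive, antisymmetric relation \(\sqsubseteq\). It is \(\delta_{\mathcal V}\)-complete if for all \(x,y:X\) with \(x\sqsubseteq y\) and every proposition \(P:\mathcal V\), the family \(\delta_{x,y,P}:\mathbf 1+P\to X\) given by \(\mathrm{inl}(\star)\mapsto x\), \(\mathrm{inr}(p)\mapsto y\) has a supremum \(\bigvee\delta_{x,y,P}\). It is nontrivial if it comes with designated \(x,y:X\) with \(x\sqsubseteq y\) and \(x\neq y\). For a \(\delta_{\mathcal V}\)-complete poset, \(x\) is strictly below \(y\) if \(x\sqsubseteq y\) and for every \(z\sqsupseteq y\) and every proposition \(P:\mathcal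 V\), the equality \(z=\bigvee\delta_{x,z,P}\) implies \(P\). It is positive if it comes with designated \(x,y\) with \(x\) strictly below \(y\). It is locally small if there is \(\sqsubseteq_{\mathcal V}:X\to X\to\mathcal V\) with \((x\sqsubseteq y)\simeq(x\sqsubseteq_{\mathcal V}y)\) for all \(x,y\); it is small if it is locally small and its carrier is \(\mathcal V\)-small. -}

{-# OPTIONS --without-K #-}
module Defs where

open import Level using (Level; _⊔_; suc; zero; Setω)
open import Data.Product using (Σ; _×_; _,_; proj₁; proj₂)
open import Data.Sum using (_⊎_; inj₁; inj₂)
open import Data.Unit using (⊤; tt)
open import Relation.Nullary using (¬_)
open import Relation.Binary.PropositionalEquality using (_≡_; _≢_)

is-prop : ∀ {a} → Set a → Set a
is-prop X = (x y : X) → x ≡ y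

-- Function extensionality and propositional extensionality
-- (ambient axioms of the paper; taken as hypotheses of the theorem).
FunExt : Setω
FunExt = ∀ {a b} {A : Set a} {B : A → Set b} {f g : (x : A) → B x}
       → ((x : A) → f x ≡ g x) → f ≡ g

PropExt : Setω
PropExt = ∀ {a} {P Q : Set a} → is-prop P → is-prop Q
        → (P → Q) → (Q → P) → P ≡ Q

is-equiv : ∀ {a b} {A : Set a} {B : Set b} → (A → B) → Set (a ⊔ b)
is-equiv {A = A} {B} f =
  (Σ (B → A) λ g → (y : B) → f (g y) ≡ y) ×
  (Σ (B → A) λ h → (x : A) → h (f x) ≡ x)

_≃_ : ∀ {a b} → Set a → Set b → Set (a ⊔ b)
A ≃ B = Σ (A → B) is-equiv

is-small : ∀ 𝓥 {a} → Set a → Set (suc 𝓥 ⊔ a)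
is-small 𝓥 X = Σ (Set 𝓥) λ Y → Y ≃ X

Ω : ∀ 𝓥 → Set (suc 𝓥)
Ω 𝓥 = Σ (Set 𝓥) is-prop

Ω¬¬ : ∀ 𝓥 → Set (suc 𝓥)
Ω¬¬ 𝓥 = Σ (Set 𝓥) λ P → is-prop P × (¬ ¬ P → P)

record Poset (𝓤 𝓣 : Level) : Set (suc (𝓤 ⊔ 𝓣)) where
  field
    Carrier    : Set 𝓤
    _⊑_        : Carrier → Carrier → Set 𝓣
    ⊑-prop     : (x y : Carrier) → is-prop (x ⊑ y)
    ⊑-refl     : (x : Carrier) → x ⊑ x
    ⊑-trans    : (x y z : Carrier) → x ⊑ y → y ⊑ z → x ⊑ z
    ⊑-antisym  : (x y : Carrier) → x ⊑ y → y ⊑ x → x ≡ y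

module _ {𝓤 𝓣 : Level} (X : Poset 𝓤 𝓣) where
  open Poset X

  is-sup : ∀ {i} {I : Set i} → (I → Carrier) → Carrier → Set (𝓤 ⊔ 𝓣 ⊔ i)
  is-sup {I = I} α s =
    ((k : I) → α k ⊑ s) ×
    ((u : Carrier) → ((k : I) → α k ⊑ u) → s ⊑ u)

  δ : ∀ {𝓥} (x y : Carrier) (P : Set 𝓥) → ⊤ ⊎ P → Carrier
  δ x y P (inj₁ _) = x
  δ x y P (inj₂ _) = y

  -- δ_V-completeness (as structure: a chosen supremum for each such family)
  δ-complete : ∀ 𝓥 → Set (suc 𝓥 ⊔ 𝓤 ⊔ 𝓣)
  δ-complete 𝓥 = (x y : Carrier) → x ⊑ y → (P : Set 𝓥) → is-prop P
               → Σ Carrier λ s → is-sup (δ x y P) s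

  nontrivial : Set (𝓤 ⊔ 𝓣)
  nontrivial = Σ Carrier λ x → Σ Carrier λ y → (x ⊑ y) × (x ≢ y)

  strictly-below : ∀ {𝓥} → δ-complete 𝓥 → Carrier → Carrier → Set (suc 𝓥 ⊔ 𝓤 ⊔ 𝓣)
  strictly-below {𝓥} c x y =
    Σ (x ⊑ y) λ x⊑y →
      (z : Carrier) (y⊑z : y ⊑ z) (P : Set 𝓥) (i : is-prop P)
      → z ≡ proj₁ (c x z (⊑-trans x y z x⊑y y⊑z) P i) → P

  positive : ∀ {𝓥} → δ-complete 𝓥 → Set (suc 𝓥 ⊔ 𝓤 ⊔ 𝓣)
  positive c = Σ Carrier λ x → Σ Carrier λ y → strictly-below c x y

  locally-small : ∀ 𝓥 → Set (suc 𝓥 ⊔ 𝓤 ⊔ 𝓣)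
  locally-small 𝓥 = Σ (Carrier → Carrier → Set 𝓥) λ _⊑ᵥ_ →
                      (x y : Carrier) → (x ⊑ y) ≃ (x ⊑ᵥ y)

  small : ∀ 𝓥 → Set (suc 𝓥 ⊔ 𝓤 ⊔ 𝓣)
  small 𝓥 = locally-small 𝓥 × is-small 𝓥 Carrier

NontrivialSmallδPoset : ∀ 𝓥 𝓤 𝓣 → Set (suc (𝓥 ⊔ 𝓤 ⊔ 𝓣))
NontrivialSmallδPoset 𝓥 𝓤 𝓣 =
  Σ (Poset 𝓤 𝓣) λ X → δ-complete X 𝓥 × nontrivial X × small X 𝓥

PositiveSmallδPoset : ∀ 𝓥 𝓤 𝓣 → Set (suc (𝓥 ⊔ 𝓤 ⊔ 𝓣))
PositiveSmallδPoset 𝓥 𝓤 𝓣 =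
  Σ (Poset 𝓤 𝓣) λ X → Σ (δ-complete X 𝓥) λ c → positive X c × small X 𝓥

record ThereIsNontrivialSmallδPoset (𝓥 : Level) : Setω where
  constructor there-is
  field
    𝓤 𝓣     : Level
    witness : NontrivialSmallδPoset 𝓥 𝓤 𝓣

record ThereIsPositiveSmallδPoset (𝓥 : Level) : Setω where
  constructor there-is
  field
    𝓤 𝓣     : Level
    witness : PositiveSmallδPoset 𝓥 𝓤 𝓣

record _⇔ω_ (A : Setω) (B : Setω) : Setω where
  constructor mk⇔ω
  field
    to   : A → B
    from : B → A

record _×ω_ (A : Setω) (B : Setω) : Setω where
  constructor _,ω_
  field
    fst : A
    snd : B

record Liftω {a} (A : Set a) : Setω where
  constructor liftω
  field lowerω : A

{-# OPTIONS --safe --without-K #-}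

-- Given x ⊑ y with x ≠ y (resp. x strictly below y), the map P ↦ ⋁ δ_{x,y,P}
-- exhibits Ω¬¬ (resp. Ω) as a retract of the carrier, with retraction
-- z ↦ ¬ (z ⊑ x) (resp. z ↦ y ⊑ z); these are 𝓥-valued because the order is
-- locally small, and a retract of a small poset is small.  Conversely Ω¬¬ and
-- Ω, ordered by implication, have all 𝓥-indexed joins (¬¬ Σ in Ω¬¬, and in Ω
-- an impredicative encoding over a small copy of Ω), and ⊥ ≠ ⊤ there, indeed
-- ⊥ is strictly below ⊤ in Ω.

module Submission where

open import Level using (Level) renaming (suc to lsuc)
open import Defs
open import Data.Product using (Σ; _×_; _,_; proj₁; proj₂)
open import Data.Sum using (inj₁; inj₂)
open import Data.Unit.Polymorphic using () renaming (⊤ to 𝟙; tt to ⋆)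
open import Data.Empty using (⊥-elim)
open import Data.Empty.Polymorphic using () renaming (⊥ to 𝟘; ⊥-elim to 𝟘-elim)
open import Function using (id)
open import Relation.Nullary using (¬_)
open import Relation.Nullary.Negation using (negated-stable)
open import Relation.Binary.PropositionalEquality
  using (_≡_; refl; sym; trans; cong; cong₂; subst; trans-symˡ; module ≡-Reasoning)

module _ {a b} {A : Set a} {B : Set b} (e : A ≃ B) where

  ≃-to : A → B
  ≃-to = proj₁ e

  ≃-from : B → A
  ≃-from = proj₁ (proj₁ (proj₂ e))

  ≃-to∘from : ∀ y → ≃-to (≃-from y) ≡ y
  ≃-to∘from = proj₂ (proj₁ (proj₂ e))

  ≃-from∘to : ∀ x → ≃-from (≃-to x) ≡ x
  ≃-from∘to x = begin
    ≃-from (≃-to x)           ≡⟨ sym (h∘to (≃-from (≃-to x))) ⟩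
    h (≃-to (≃-from (≃-to x))) ≡⟨ cong h (≃-to∘from (≃-to x)) ⟩
    h (≃-to x)                ≡⟨ h∘to x ⟩
    x                         ∎
    where
    open ≡-Reasoning
    h = proj₁ (proj₂ (proj₂ e))
    h∘to = proj₂ (proj₂ (proj₂ e))

  ≃-preserves-prop : is-prop A → is-prop B
  ≃-preserves-prop p y y' = begin
    y                   ≡⟨ sym (≃-to∘from y) ⟩
    ≃-to (≃-from y)     ≡⟨ cong ≃-to (p (≃-from y) (≃-from y')) ⟩
    ≃-to (≃-from y')    ≡⟨ ≃-to∘from y' ⟩
    y'                  ∎
    where open ≡-Reasoning

mk≃ : ∀ {a b} {A : Set a} {B : Set b} (f : A → B) (g : B → A)
    → (∀ y → f (g y) ≡ y) → (∀ x → g (f x) ≡ x) → A ≃ B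
mk≃ f g f∘g g∘f = f , (g , f∘g) , (g , g∘f)

≃-refl : ∀ {a} {A : Set a} → A ≃ A
≃-refl = mk≃ id id (λ _ → refl) (λ _ → refl)

×-prop : ∀ {a b} {A : Set a} {B : Set b} → is-prop A → is-prop B → is-prop (A × B)
×-prop p q (x , y) (x' , y') = cong₂ _,_ (p x x') (q y y')

Σ-≡-prop : ∀ {a b} {A : Set a} {B : A → Set b} → ((x : A) → is-prop (B x))
         → {x x' : A} {u : B x} {u' : B x'} → x ≡ x' → (x , u) ≡ (x' , u')
Σ-≡-prop B-prop {u = u} {u'} refl = cong (_ ,_) (B-prop _ u u')

prop-is-set : ∀ {a} {A : Set a} → is-prop A → {x y : A} (u v : x ≡ y) → u ≡ v
prop-is-set {A = A} p {x} u v = trans (canonical u) (sym (canonical v))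
  where
  canonical : ∀ {y} (u : x ≡ y) → u ≡ trans (sym (p x x)) (p x y)
  canonical refl = sym (trans-symˡ (p x x))

module _ {𝓤 𝓣 : Level} (X : Poset 𝓤 𝓣) where
  open Poset X

  sup-unique : ∀ {i} {I : Set i} {α : I → Carrier} {s s' : Carrier}
             → is-sup X α s → is-sup X α s' → s ≡ s'
  sup-unique (s-ub , s-least) (s'-ub , s'-least) =
    ⊑-antisym _ _ (s-least _ s'-ub) (s'-least _ s-ub)

  module _ {𝓥} {x y s : Carrier} {P : Set 𝓥} (s-sup : is-sup X (δ X x y P) s) where

    δ-sup-above : P → y ⊑ s
    δ-sup-above p = proj₁ s-sup (inj₂ p)

    δ-sup-below-if-not : ¬ P → s ⊑ x
    δ-sup-below-if-not ¬p = proj₂ s-sup x λ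
      { (inj₁ _) → ⊑-refl x
      ; (inj₂ p) → ⊥-elim (¬p p) }

    δ-sup-raise : y ⊑ s → is-sup X (δ X x s P) s
    δ-sup-raise y⊑s = upper , least
      where
      upper : ∀ k → δ X x s P k ⊑ s
      upper (inj₁ t) = proj₁ s-sup (inj₁ t)
      upper (inj₂ _) = ⊑-refl s
      least : ∀ u → (∀ k → δ X x s P k ⊑ u) → s ⊑ u
      least u bound = proj₂ s-sup u λ
        { (inj₁ t) → bound (inj₁ t)
        ; (inj₂ p) → ⊑-trans y s u y⊑s (bound (inj₂ p)) }

  has-𝓥-joins⇒δ-complete : ∀ {𝓥}
    → (∀ {I : Set 𝓥} (α : I → Carrier) → Σ Carrier (is-sup X α))
    → δ-complete X 𝓥
  has-𝓥-joins⇒δ-complete join x y _ P _ = join (δ X x y P)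

order-in-𝓥⇒locally-small : ∀ {𝓤 𝓥} (X : Poset 𝓤 𝓥) → locally-small X 𝓥
order-in-𝓥⇒locally-small X = Poset._⊑_ X , λ _ _ → ≃-refl

-- T is equivalent to the type of fixed points of s ∘ r, and in a locally small
-- poset being such a fixed point is a 𝓥-small proposition.
small-poset-retract-is-small : ∀ {𝓥 𝓤 𝓣 t} (X : Poset 𝓤 𝓣) → small X 𝓥
  → {T : Set t} (s : T → Poset.Carrier X) (r : Poset.Carrier X → T)
  → (∀ τ → r (s τ) ≡ τ) → is-small 𝓥 T
small-poset-retract-is-small {𝓥} X ((_⊑ᵥ_ , ⊑≃⊑ᵥ) , (Y , e)) {T} s r r∘s =
  Fix , mk≃ (λ (w , _) → r (≃-to e w)) from to∘from from∘to
  where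
  open Poset X
  is-fixed : Carrier → Set 𝓥
  is-fixed z = (s (r z) ⊑ᵥ z) × (z ⊑ᵥ s (r z))
  is-fixed-prop : ∀ z → is-prop (is-fixed z)
  is-fixed-prop z = ×-prop (≃-preserves-prop (⊑≃⊑ᵥ _ _) (⊑-prop _ _))
                           (≃-preserves-prop (⊑≃⊑ᵥ _ _) (⊑-prop _ _))
  Fix : Set 𝓥
  Fix = Σ Y λ w → is-fixed (≃-to e w)
  s-fixed : ∀ τ → is-fixed (s τ)
  s-fixed τ = subst (λ σ → (s σ ⊑ᵥ s τ) × (s τ ⊑ᵥ s σ)) (sym (r∘s τ))
                    (≃-to (⊑≃⊑ᵥ _ _) (⊑-refl _) , ≃-to (⊑≃⊑ᵥ _ _) (⊑-refl _))
  from : T → Fix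
  from τ = ≃-from e (s τ) , subst is-fixed (sym (≃-to∘from e (s τ))) (s-fixed τ)
  to∘from : ∀ τ → r (≃-to e (≃-from e (s τ))) ≡ τ
  to∘from τ = trans (cong r (≃-to∘from e (s τ))) (r∘s τ)
  from∘to : ∀ σ → from (r (≃-to e (proj₁ σ))) ≡ σ
  from∘to (w , sr⊑ , ⊑sr) = Σ-≡-prop (λ w → is-fixed-prop (≃-to e w))
    (trans (cong (≃-from e) (⊑-antisym _ _ (≃-from (⊑≃⊑ᵥ _ _) sr⊑) (≃-from (⊑≃⊑ᵥ _ _) ⊑sr)))
           (≃-from∘to e w))

module _ (fe : FunExt) (pe : PropExt) where

  Π-prop : ∀ {a b} {A : Set a} {B : A → Set b}
         → ((x : A) → is-prop (B x)) → is-prop ((x : A) → B x)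
  Π-prop B-prop f g = fe λ x → B-prop x (f x) (g x)

  is-prop-is-prop : ∀ {a} {A : Set a} → is-prop (is-prop A)
  is-prop-is-prop p q = fe λ x → fe λ y → prop-is-set p (p x y) (q x y)

  ¬-prop : ∀ {a} {A : Set a} → is-prop (¬ A)
  ¬-prop = Π-prop λ _ ()

  ¬¬-stable-prop-is-prop : ∀ {a} (A : Set a) → is-prop (is-prop A × (¬ ¬ A → A))
  ¬¬-stable-prop-is-prop A (p , st) (p' , st') =
    cong₂ _,_ (is-prop-is-prop p p') (fe λ h → p (st h) (st' h))

  Ω-≡ : ∀ {𝓥} (P Q : Ω 𝓥) → (proj₁ P → proj₁ Q) → (proj₁ Q → proj₁ P) → P ≡ Q
  Ω-≡ (_ , p) (_ , q) f g = Σ-≡-prop (λ _ → is-prop-is-prop) (pe p q f g)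

  Ω¬¬-≡ : ∀ {𝓥} (P Q : Ω¬¬ 𝓥) → (proj₁ P → proj₁ Q) → (proj₁ Q → proj₁ P) → P ≡ Q
  Ω¬¬-≡ (_ , p , _) (_ , q , _) f g = Σ-≡-prop ¬¬-stable-prop-is-prop (pe p q f g)

  Ω-poset : ∀ 𝓥 → Poset (lsuc 𝓥) 𝓥
  Ω-poset 𝓥 = record
    { Carrier   = Ω 𝓥
    ; _⊑_       = λ P Q → proj₁ P → proj₁ Q
    ; ⊑-prop    = λ _ Q → Π-prop λ _ → proj₂ Q
    ; ⊑-refl    = λ _ → id
    ; ⊑-trans   = λ _ _ _ f g → λ p → g (f p)
    ; ⊑-antisym = Ω-≡
    }

  Ω¬¬-poset : ∀ 𝓥 → Poset (lsuc 𝓥) 𝓥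
  Ω¬¬-poset 𝓥 = record
    { Carrier   = Ω¬¬ 𝓥
    ; _⊑_       = λ P Q → proj₁ P → proj₁ Q
    ; ⊑-prop    = λ _ Q → Π-prop λ _ → proj₁ (proj₂ Q)
    ; ⊑-refl    = λ _ → id
    ; ⊑-trans   = λ _ _ _ f g → λ p → g (f p)
    ; ⊑-antisym = Ω¬¬-≡
    }

  Ω¬¬-join : ∀ {𝓥} {I : Set 𝓥} (α : I → Ω¬¬ 𝓥) → Σ (Ω¬¬ 𝓥) (is-sup (Ω¬¬-poset 𝓥) α)
  Ω¬¬-join α =
    ((¬ ¬ (Σ _ λ i → proj₁ (α i))) , ¬-prop , negated-stable)
    , (λ i a ¬j → ¬j (i , a))
    , λ (_ , _ , U-stable) bound ¬¬j →
        U-stable λ ¬u → ¬¬j λ (i , a) → ¬u (bound i a)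

  -- The join quantifies over the small copy Y of Ω, so it lives in 𝓥.
  Ω-small⇒Ω-join : ∀ {𝓥} → is-small 𝓥 (Ω 𝓥)
    → {I : Set 𝓥} (α : I → Ω 𝓥) → Σ (Ω 𝓥) (is-sup (Ω-poset 𝓥) α)
  Ω-small⇒Ω-join {𝓥} (Y , e) {I} α =
    (⋁ , Π-prop λ w → Π-prop λ _ → proj₂ (≃-to e w))
    , (λ i a w bound → bound i a)
    , λ V bound j → decode V (j (≃-from e V) λ i a → encode V (bound i a))
    where
    U : Y → Set 𝓥
    U w = proj₁ (≃-to e w)
    ⋁ : Set 𝓥
    ⋁ = (w : Y) → ((i : I) → proj₁ (α i) → U w) → U w
    decode : (V : Ω 𝓥) → U (≃-from e V) → proj₁ V
    decode V = subst id (cong proj₁ (≃-to∘from e V))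
    encode : (V : Ω 𝓥) → proj₁ V → U (≃-from e V)
    encode V = subst id (sym (cong proj₁ (≃-to∘from e V)))

  ⊥Ω¬¬ ⊤Ω¬¬ : ∀ {𝓥} → Ω¬¬ 𝓥
  ⊥Ω¬¬ = 𝟘 , (λ ()) , λ ¬¬⊥ → ⊥-elim (¬¬⊥ λ ())
  ⊤Ω¬¬ = 𝟙 , (λ _ _ → refl) , λ _ → ⋆

  Ω¬¬-nontrivial : ∀ {𝓥} → nontrivial (Ω¬¬-poset 𝓥)
  Ω¬¬-nontrivial = ⊥Ω¬¬ , ⊤Ω¬¬ , (λ ()) , λ ⊥≡⊤ → 𝟘-elim (subst proj₁ (sym ⊥≡⊤) ⋆)

  -- ⋁ δ_{⊥,z,P} implies P whatever the chosen suprema, as P bounds the family.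
  Ω-positive : ∀ {𝓥} (c : δ-complete (Ω-poset 𝓥) 𝓥) → positive (Ω-poset 𝓥) c
  Ω-positive c = (𝟘 , λ ()) , (𝟙 , λ _ _ → refl) , (λ ()) ,
    λ z ⊤⇒z P P-prop z≡⋁ →
      let (_ , _ , least) = c _ z _ P P-prop
      in least (P , P-prop) (λ { (inj₁ _) (); (inj₂ p) _ → p })
               (subst proj₁ z≡⋁ (⊤⇒z ⋆))

  nontrivial-small-δ-complete⇒Ω¬¬-small : ∀ {𝓥 𝓤 𝓣} (X : Poset 𝓤 𝓣)
    → δ-complete X 𝓥 → nontrivial X → small X 𝓥 → is-small 𝓥 (Ω¬¬ 𝓥)
  nontrivial-small-δ-complete⇒Ω¬¬-small {𝓥} X c (x , y , x⊑y , x≢y) sm@((_⊑ᵥ_ , ⊑≃⊑ᵥ) , _) =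
    small-poset-retract-is-small X sm s r r∘s
    where
    open Poset X
    s : Ω¬¬ 𝓥 → Carrier
    s (P , P-prop , _) = proj₁ (c x y x⊑y P P-prop)
    s-sup : ∀ P → is-sup X (δ X x y (proj₁ P)) (s P)
    s-sup (P , P-prop , _) = proj₂ (c x y x⊑y P P-prop)
    r : Carrier → Ω¬¬ 𝓥
    r z = (¬ (z ⊑ᵥ x)) , ¬-prop , negated-stable
    r∘s : ∀ P → r (s P) ≡ P
    r∘s P@(_ , _ , P-stable) = Ω¬¬-≡ (r (s P)) P
      (λ s⋢x → P-stable λ ¬p → s⋢x (≃-to (⊑≃⊑ᵥ _ _) (δ-sup-below-if-not X (s-sup P) ¬p)))
      (λ p s⊑ᵥx → x≢y (⊑-antisym x y x⊑y
        (⊑-trans y (s P) x (δ-sup-above X (s-sup P) p) (≃-from (⊑≃⊑ᵥ _ _) s⊑ᵥx))))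

  positive-small-δ-complete⇒Ω-small : ∀ {𝓥 𝓤 𝓣} (X : Poset 𝓤 𝓣)
    → (c : δ-complete X 𝓥) → positive X c → small X 𝓥 → is-small 𝓥 (Ω 𝓥)
  positive-small-δ-complete⇒Ω-small {𝓥} X c (x , y , x⊑y , x≺y) sm@((_⊑ᵥ_ , ⊑≃⊑ᵥ) , _) =
    small-poset-retract-is-small X sm s r r∘s
    where
    open Poset X
    s : Ω 𝓥 → Carrier
    s (P , P-prop) = proj₁ (c x y x⊑y P P-prop)
    s-sup : ∀ P → is-sup X (δ X x y (proj₁ P)) (s P)
    s-sup (P , P-prop) = proj₂ (c x y x⊑y P P-prop)
    r : Carrier → Ω 𝓥
    r z = (y ⊑ᵥ z) , ≃-preserves-prop (⊑≃⊑ᵥ y z) (⊑-prop y z)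
    y⊑s⇒P : ∀ P → y ⊑ s P → proj₁ P
    y⊑s⇒P P@(P₀ , P-prop) y⊑s = x≺y (s P) y⊑s P₀ P-prop
      (sup-unique X (δ-sup-raise X (s-sup P) y⊑s) (proj₂ (c x (s P) _ P₀ P-prop)))
    r∘s : ∀ P → r (s P) ≡ P
    r∘s P = Ω-≡ (r (s P)) P
      (λ y⊑ᵥs → y⊑s⇒P P (≃-from (⊑≃⊑ᵥ _ _) y⊑ᵥs))
      (λ p → ≃-to (⊑≃⊑ᵥ _ _) (δ-sup-above X (s-sup P) p))

theorem4p24 : FunExt → PropExt → (𝓥 : Level)
    → (ThereIsNontrivialSmallδPoset 𝓥 ⇔ω Liftω (is-small 𝓥 (Ω¬¬ 𝓥)))
      ×ω (ThereIsPositiveSmallδPoset 𝓥 ⇔ω Liftω (is-small 𝓥 (Ω 𝓥)))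
theorem4p24 fe pe 𝓥 =
  mk⇔ω (λ { (there-is _ _ (X , c , nt , sm)) →
              liftω (nontrivial-small-δ-complete⇒Ω¬¬-small fe pe X c nt sm) })
       (λ { (liftω Ω¬¬-small) → there-is _ _
              ( Ω¬¬-poset fe pe 𝓥
              , has-𝓥-joins⇒δ-complete (Ω¬¬-poset fe pe 𝓥) (Ω¬¬-join fe pe)
              , Ω¬¬-nontrivial fe pe
              , order-in-𝓥⇒locally-small (Ω¬¬-poset fe pe 𝓥) , Ω¬¬-small) })
  ,ω
  mk⇔ω (λ { (there-is _ _ (X , c , pos , sm)) →
              liftω (positive-small-δ-complete⇒Ω-small fe pe X c pos sm) })
       (λ { (liftω Ω-small) →
              let c = has-𝓥-joins⇒δ-complete (Ω-poset fe pe 𝓥) (Ω-small⇒Ω-join fe pe Ω-small)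
              in there-is _ _
                ( Ω-poset fe pe 𝓥 , c , Ω-positive fe pe c
                , order-in-𝓥⇒locally-small (Ω-poset fe pe 𝓥) , Ω-small) })
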